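{- For every integer $n\ge 2$, \[p_b(P_n)=\begin{cases} \frac{n}{4} & \text{if } n\equiv 0\pmod 8,\\ 2\left\lfloor\frac{n}{8}\right\rfloor+1 & \text{if } n\equiv 1,2,3\pmod 8,\\ 2\left\lfloor\frac{n}{8}\right\rfloor+2 & \text{if } n\equiv 4,5,6,7\pmod 8,\end{cases}\] where $P_n$ is the path of order $n$.
   Context: For a graph $G=(V,E)$, a broadcast is a function $f:V\to\{0,\dots,\operatorname{diam}(G)\}$ with $f(v)\le e_G(v)$ (eccentricity) for all $v$. Let $V^+_f=\{v: f(v)>0\}$ and $H_f(u)=\{v\in V^+_f: d_G(u,v)\le f(v)\}$. The cost is $\sigma(f)=\sum_v f(v)$. $f$ is a packing broadcast if $|H_f(u)|\le1$ for every $u\in V$; it is maximal if no packing broadcast $g\ne f$ satisfies $g\ge f$ pointwise. $p_b(G)$ is the minimum cost of a maximal packing broadcast on $G$. -}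

module Defs where

open import Data.Nat using (ℕ; zero; suc; _+_; _*_; _∸_; _≤_; _<_; _⊔_; ∣_-_∣)
open import Data.Nat.DivMod using (_/_; _%_)
open import Data.Fin using (Fin; toℕ)
open import Data.List using (List; map; foldr; allFin)
open import Data.Nat.ListAction using (sum)
open import Data.Product using (Σ; _×_; _,_)
open import Relation.Binary.PropositionalEquality using (_≡_)

-- A (connected) graph on vertex set Fin n, given through its distance function.
Dist : ℕ → Set
Dist n = Fin n → Fin n → ℕ

ecc : ∀ {n} → Dist n → Fin n → ℕ
ecc {n} d v = foldr _⊔_ 0 (map (λ u → d u v) (allFin n))

diam : ∀ {n} → Dist n → ℕ
diam {n} d = foldr _⊔_ 0 (map (ecc d) (allFin n))

IsBroadcast : ∀ {n} → Dist n → (Fin n → ℕ) → Set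
IsBroadcast d f = ∀ v → (f v ≤ diam d) × (f v ≤ ecc d v)

InH : ∀ {n} → Dist n → (Fin n → ℕ) → Fin n → Fin n → Set
InH d f u v = (0 < f v) × (d u v ≤ f v)

IsPackingBroadcast : ∀ {n} → Dist n → (Fin n → ℕ) → Set
IsPackingBroadcast d f =
  IsBroadcast d f × (∀ u v w → InH d f u v → InH d f u w → v ≡ w)

IsMaximalPacking : ∀ {n} → Dist n → (Fin n → ℕ) → Set
IsMaximalPacking d f =
  IsPackingBroadcast d f ×
  (∀ g → IsPackingBroadcast d g → (∀ v → f v ≤ g v) → ∀ v → g v ≡ f v)

cost : ∀ {n} → (Fin n → ℕ) → ℕ
cost {n} f = sum (map f (allFin n))

PbIs : ∀ {n} → Dist n → ℕ → Set
PbIs d k =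
  Σ _ (λ f → IsMaximalPacking d f × cost f ≡ k) ×
  (∀ f → IsMaximalPacking d f → k ≤ cost f)

pathDist : ∀ n → Dist n
pathDist n i j = ∣ toℕ i - toℕ j ∣

pbPathValue : ℕ → ℕ
pbPathValue n with n % 8
... | 0 = n / 4
... | 1 = 2 * (n / 8) + 1
... | 2 = 2 * (n / 8) + 1
... | 3 = 2 * (n / 8) + 1
... | _ = 2 * (n / 8) + 2

module Submission where

-- A packing broadcast f is maximal iff no single value can be raised by one, i.e. iff
-- every v with f(v) < e(v) is blocked: some vertex within distance f(v)+1 of v already hears a
-- broadcast from another vertex.  On the path this says that every vertex hearing nothing has a
-- neighbour that hears something, and that every broadcasting vertex either reaches both ends or the
-- first vertex just beyond its range on one side hears another broadcast.
-- Lower bound: charge each vertex to a broadcaster it hears or, if it hears none, to a broadcaster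
-- whose range ends next to it.  A broadcaster v is charged at most 4 f(v) vertices, so n ≤ 4 σ(f).
-- When n = 4 σ(f) every broadcaster has f(v) = 1 and is blocked on exactly one side, and the
-- broadcasters blocked on the left are those blocked on the right shifted by 3, so σ(f) is even.
-- The value claimed for p_b(P_n) is the least σ compatible with these two constraints.
-- Upper bound: the block 00100100 repeated in front of a suitable pattern on 8 to 15 vertices (or a
-- short pattern when n < 8); maximality is a condition on windows of radius 3, checked by evaluation.

open import Defs
open import Data.Nat
open import Data.Nat.Properties
open import Data.Nat.DivMod
open import Data.Nat.Tactic.RingSolver using (solve-∀)
open import Data.Nat.ListAction using (sum)
open import Algebra.Properties.CommutativeSemigroup +-commutativeSemigroup using (interchange)
open import Data.Bool.Base using (T; not)
open import Data.Bool.Properties using (T-not-≡)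
open import Data.Empty using (⊥; ⊥-elim)
open import Data.Fin as Fin using (Fin; toℕ; fromℕ<; fromℕ)
open import Data.Fin.Properties using (any?; toℕ-fromℕ<; fromℕ<-toℕ; toℕ-fromℕ; toℕ<n; toℕ-injective)
open import Data.List using (List; []; _∷_; map; foldr; allFin; tabulate)
open import Data.List.Properties using (map-tabulate)
open import Data.Product using (Σ; ∃; _×_; _,_; proj₁; proj₂)
open import Data.Sum using (_⊎_; inj₁; inj₂)
open import Function using (_∘_)
open import Function.Bundles using (Equivalence)
open import Relation.Binary.Definitions using (tri<; tri≈; tri>)
open import Relation.Binary.PropositionalEquality
open import Relation.Nullary using (¬_; Dec; yes; no)
open import Relation.Nullary.Decidable using (_×-dec_; _⊎-dec_; _→-dec_; ¬?; T?; True; toWitness)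

∑ : ℕ → (ℕ → ℕ) → ℕ
∑ zero    g = 0
∑ (suc n) g = ∑ n g + g n

∀<-pred : ∀ {n} {P : ℕ → Set} → (∀ i → i < suc n → P i) → ∀ i → i < n → P i
∀<-pred p i i<n = p i (m<n⇒m<1+n i<n)

∑-cong : ∀ n {g h} → (∀ i → i < n → g i ≡ h i) → ∑ n g ≡ ∑ n h
∑-cong zero    g≡h = refl
∑-cong (suc n) g≡h = cong₂ _+_ (∑-cong n (∀<-pred g≡h)) (g≡h n ≤-refl)

∑-mono-≤ : ∀ n {g h} → (∀ i → i < n → g i ≤ h i) → ∑ n g ≤ ∑ n h
∑-mono-≤ zero    g≤h = z≤n
∑-mono-≤ (suc n) g≤h = +-mono-≤ (∑-mono-≤ n (∀<-pred g≤h)) (g≤h n ≤-refl)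

∑-zero : ∀ n → ∑ n (λ _ → 0) ≡ 0
∑-zero zero    = refl
∑-zero (suc n) = trans (+-identityʳ _) (∑-zero n)

∑-one : ∀ n → ∑ n (λ _ → 1) ≡ n
∑-one zero    = refl
∑-one (suc n) = trans (cong (_+ 1) (∑-one n)) (+-comm n 1)

∑-distrib-+ : ∀ n g h → ∑ n (λ i → g i + h i) ≡ ∑ n g + ∑ n h
∑-distrib-+ zero    g h = refl
∑-distrib-+ (suc n) g h =
  trans (cong (_+ (g n + h n)) (∑-distrib-+ n g h)) (interchange (∑ n g) (∑ n h) (g n) (h n))

∑-distribˡ-* : ∀ n c g → ∑ n (λ i → c * g i) ≡ c * ∑ n g
∑-distribˡ-* zero    c g = sym (*-zeroʳ c)
∑-distribˡ-* (suc n) c g = trans (cong (_+ c * g n) (∑-distribˡ-* n c g)) (sym (*-distribˡ-+ c (∑ n g) (g n)))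

∑-comm : ∀ n m (h : ℕ → ℕ → ℕ) → ∑ n (λ i → ∑ m (h i)) ≡ ∑ m (λ j → ∑ n (λ i → h i j))
∑-comm zero    m h = sym (∑-zero m)
∑-comm (suc n) m h = trans (cong (_+ ∑ m (h n)) (∑-comm n m h)) (sym (∑-distrib-+ m (λ j → ∑ n (λ i → h i j)) (h n)))

≤-∑ : ∀ n g {i} → i < n → g i ≤ ∑ n g
≤-∑ (suc n) g {i} i<1+n with m≤n⇒m<n∨m≡n (≤-pred i<1+n)
... | inj₁ i<n  = ≤-trans (≤-∑ n g i<n) (m≤m+n _ _)
... | inj₂ refl = m≤n+m _ _

∑-+ : ∀ k m g → ∑ (k + m) g ≡ ∑ k g + ∑ m (λ i → g (k + i))
∑-+ k zero    g = trans (cong (λ x → ∑ x g) (+-identityʳ k)) (sym (+-identityʳ _))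
∑-+ k (suc m) g = trans (cong (λ x → ∑ x g) (+-suc k m))
  (trans (cong (_+ g (k + m)) (∑-+ k m g)) (+-assoc (∑ k g) _ _))

∑-vanishing-tail : ∀ n m g → (∀ i → n ≤ i → g i ≡ 0) → ∑ (n + m) g ≡ ∑ n g
∑-vanishing-tail n m g g≡0 = begin
  ∑ (n + m) g                     ≡⟨ ∑-+ n m g ⟩
  ∑ n g + ∑ m (λ i → g (n + i))   ≡⟨ cong (∑ n g +_) (∑-cong m (λ i _ → g≡0 (n + i) (m≤m+n n i))) ⟩
  ∑ n g + ∑ m (λ _ → 0)           ≡⟨ cong (∑ n g +_) (∑-zero m) ⟩
  ∑ n g + 0                       ≡⟨ +-identityʳ _ ⟩
  ∑ n g                           ∎
  where open ≡-Reasoning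

+-mono-≤-tight : ∀ {a b c d} → a ≤ c → b ≤ d → c + d ≤ a + b → a ≡ c × b ≡ d
+-mono-≤-tight {a} {b} {c} {d} a≤c b≤d c+d≤a+b =
  ≤-antisym a≤c (+-cancelʳ-≤ d c a (≤-trans c+d≤a+b (+-monoʳ-≤ a b≤d))) ,
  ≤-antisym b≤d (+-cancelˡ-≤ c d b (≤-trans c+d≤a+b (+-monoˡ-≤ b a≤c)))

∑-mono-≤-tight : ∀ n {g h} → (∀ i → i < n → g i ≤ h i) → ∑ n h ≤ ∑ n g → ∀ i → i < n → g i ≡ h i
∑-mono-≤-tight (suc n) g≤h h≤g i i<1+n
  with +-mono-≤-tight (∑-mono-≤ n (∀<-pred g≤h)) (g≤h n ≤-refl) h≤g | m≤n⇒m<n∨m≡n (≤-pred i<1+n)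
... | ∑g≡∑h , _   | inj₁ i<n  = ∑-mono-≤-tight n (∀<-pred g≤h) (≤-reflexive (sym ∑g≡∑h)) i i<n
... | _ , gn≡hn     | inj₂ refl = gn≡hn

∑-≤-∑-+ : ∀ n m g → ∑ n g ≤ ∑ (n + m) g
∑-≤-∑-+ n m g = ≤-trans (m≤m+n (∑ n g) _) (≤-reflexive (sym (∑-+ n m g)))

∑-≤-support : ∀ n g a L → (∀ i → g i ≤ 1) → (∀ i → 0 < g i → a ≤ i × i < a + L) → ∑ n g ≤ L
∑-≤-support n g a L g≤1 support = begin
  ∑ n g                              ≤⟨ ∑-≤-∑-+ n (a + L) g ⟩
  ∑ (n + (a + L)) g                  ≡⟨ cong (λ m → ∑ m g) (+-comm n (a + L)) ⟩
  ∑ ((a + L) + n) g                  ≡⟨ ∑-vanishing-tail (a + L) n g beyond-a+L ⟩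
  ∑ (a + L) g                        ≡⟨ ∑-+ a L g ⟩
  ∑ a g + ∑ L (λ i → g (a + i))      ≡⟨ cong (_+ ∑ L (λ i → g (a + i))) below-a ⟩
  ∑ L (λ i → g (a + i))              ≤⟨ ∑-mono-≤ L (λ i _ → g≤1 (a + i)) ⟩
  ∑ L (λ _ → 1)                      ≡⟨ ∑-one L ⟩
  L                                  ∎
  where
  open ≤-Reasoning
  vanishes : ∀ i → ¬ (a ≤ i × i < a + L) → g i ≡ 0
  vanishes i outside = n≤0⇒n≡0 (≮⇒≥ (λ g>0 → outside (support i g>0)))
  beyond-a+L : ∀ i → a + L ≤ i → g i ≡ 0
  beyond-a+L i a+L≤i = vanishes i (λ inside → <⇒≱ (proj₂ inside) a+L≤i)
  below-a : ∑ a g ≡ 0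
  below-a = trans (∑-cong a (λ i i<a → vanishes i (λ inside → <⇒≱ i<a (proj₁ inside)))) (∑-zero a)

indicator : ∀ {A : Set} → Dec A → ℕ
indicator (yes _) = 1
indicator (no  _) = 0

indicator≤1 : ∀ {A : Set} (a? : Dec A) → indicator a? ≤ 1
indicator≤1 (yes _) = ≤-refl
indicator≤1 (no  _) = z≤n

indicator-yes : ∀ {A : Set} (a? : Dec A) → A → indicator a? ≡ 1
indicator-yes (yes _) _ = refl
indicator-yes (no ¬a) a = ⊥-elim (¬a a)

indicator-no : ∀ {A : Set} (a? : Dec A) → ¬ A → indicator a? ≡ 0
indicator-no (yes a) ¬a = ⊥-elim (¬a a)
indicator-no (no  _) _  = refl

indicator>0⇒ : ∀ {A : Set} (a? : Dec A) → 0 < indicator a? → A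
indicator>0⇒ (yes a) _ = a

indicator-cong : ∀ {A B : Set} (a? : Dec A) (b? : Dec B) → (A → B) → (B → A) → indicator a? ≡ indicator b?
indicator-cong (yes _) (yes _) _   _   = refl
indicator-cong (yes a) (no ¬b) a→b _   = ⊥-elim (¬b (a→b a))
indicator-cong (no ¬a) (yes b) _   b→a = ⊥-elim (¬a (b→a b))
indicator-cong (no _)  (no _)  _   _   = refl

∣m-n∣≤o⇒m≤n+o : ∀ m n o → ∣ m - n ∣ ≤ o → m ≤ n + o
∣m-n∣≤o⇒m≤n+o zero    n       o _ = z≤n
∣m-n∣≤o⇒m≤n+o (suc m) zero    o d = d
∣m-n∣≤o⇒m≤n+o (suc m) (suc n) o d = s≤s (∣m-n∣≤o⇒m≤n+o m n o d)

∣m-n∣≡o⇒m+o≡n⊎m≡n+o : ∀ m n o → ∣ m - n ∣ ≡ o → m + o ≡ n ⊎ m ≡ n + o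
∣m-n∣≡o⇒m+o≡n⊎m≡n+o zero    n       o d = inj₁ (sym d)
∣m-n∣≡o⇒m+o≡n⊎m≡n+o (suc m) zero    o d = inj₂ d
∣m-n∣≡o⇒m+o≡n⊎m≡n+o (suc m) (suc n) o d with ∣m-n∣≡o⇒m+o≡n⊎m≡n+o m n o d
... | inj₁ m+o≡n = inj₁ (cong suc m+o≡n)
... | inj₂ m≡n+o = inj₂ (cong suc m≡n+o)

∣m-n∣≤1⇒n≡m⊎n≡1+m⊎m≡1+n : ∀ m n → ∣ m - n ∣ ≤ 1 → n ≡ m ⊎ n ≡ suc m ⊎ m ≡ suc n
∣m-n∣≤1⇒n≡m⊎n≡1+m⊎m≡1+n zero          zero          _ = inj₁ refl
∣m-n∣≤1⇒n≡m⊎n≡1+m⊎m≡1+n zero          (suc zero)    _ = inj₂ (inj₁ refl)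
∣m-n∣≤1⇒n≡m⊎n≡1+m⊎m≡1+n (suc zero)    zero          _ = inj₂ (inj₂ refl)
∣m-n∣≤1⇒n≡m⊎n≡1+m⊎m≡1+n zero          (suc (suc n)) (s≤s ())
∣m-n∣≤1⇒n≡m⊎n≡1+m⊎m≡1+n (suc (suc m)) zero          (s≤s ())
∣m-n∣≤1⇒n≡m⊎n≡1+m⊎m≡1+n (suc m)       (suc n)       d with ∣m-n∣≤1⇒n≡m⊎n≡1+m⊎m≡1+n m n d
... | inj₁ n≡m         = inj₁ (cong suc n≡m)
... | inj₂ (inj₁ n≡1+m) = inj₂ (inj₁ (cong suc n≡1+m))
... | inj₂ (inj₂ m≡1+n) = inj₂ (inj₂ (cong suc m≡1+n))

∣m+n-m∣≡n : ∀ m n → ∣ m + n - m ∣ ≡ n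
∣m+n-m∣≡n m n = trans (∣-∣-comm (m + n) m) (∣m-m+n∣≡n m n)

∣1+m-m∣≡1 : ∀ m → ∣ suc m - m ∣ ≡ 1
∣1+m-m∣≡1 m = trans (cong (λ x → ∣ x - m ∣) (+-comm 1 m)) (∣m+n-m∣≡n m 1)

∣m-1+m∣≡1 : ∀ m → ∣ m - suc m ∣ ≡ 1
∣m-1+m∣≡1 m = trans (∣-∣-comm m (suc m)) (∣1+m-m∣≡1 m)

1+k+1+k≤4k : ∀ k → 1 ≤ k → suc (k + suc k) ≤ 4 * k
1+k+1+k≤4k (suc j) _ = ≤-trans (m≤m+n _ (j + j)) (≤-reflexive (sym (4[1+j]≡ j)))
  where
  4[1+j]≡ : ∀ j → 4 * suc j ≡ suc (suc j + suc (suc j)) + (j + j)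
  4[1+j]≡ = solve-∀

4k≰1+k+k : ∀ k → 1 ≤ k → ¬ 4 * k ≤ suc (k + k)
4k≰1+k+k k 1≤k 4k≤1+k+k = 1+n≰n (≤-trans (1+k+1+k≤4k k 1≤k) (≤-trans 4k≤1+k+k (≤-reflexive (sym (+-suc k k)))))

4k≤1+k+1+k⇒k≤1 : ∀ k → 4 * k ≤ suc (k + suc k) → k ≤ 1
4k≤1+k+1+k⇒k≤1 zero          _ = z≤n
4k≤1+k+1+k⇒k≤1 (suc zero)    _ = ≤-refl
4k≤1+k+1+k⇒k≤1 (suc (suc j)) 4k≤ =
  ⊥-elim (1+n≰n (≤-trans (≤-trans (m≤m+n _ (suc (j + j))) (≤-reflexive (sym (4[2+j]≡ j)))) 4k≤))
  where
  4[2+j]≡ : ∀ j → 4 * suc (suc j) ≡ suc (suc (suc (suc j) + suc (suc (suc j)))) + suc (j + j)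
  4[2+j]≡ = solve-∀

≤-max-tabulate : ∀ {m} (h : Fin m → ℕ) i → h i ≤ foldr _⊔_ 0 (tabulate h)
≤-max-tabulate h Fin.zero    = m≤m⊔n _ _
≤-max-tabulate h (Fin.suc i) = ≤-trans (≤-max-tabulate (λ j → h (Fin.suc j)) i) (m≤n⊔m (h Fin.zero) _)

max-tabulate-≤ : ∀ {m} (h : Fin m → ℕ) {b} → (∀ i → h i ≤ b) → foldr _⊔_ 0 (tabulate h) ≤ b
max-tabulate-≤ {zero}  h h≤b = z≤n
max-tabulate-≤ {suc m} h h≤b = ⊔-lub (h≤b Fin.zero) (max-tabulate-≤ (λ j → h (Fin.suc j)) (λ j → h≤b (Fin.suc j)))

max-map-allFin : ∀ {n} (h : Fin n → ℕ) → foldr _⊔_ 0 (map h (allFin n)) ≡ foldr _⊔_ 0 (tabulate h)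
max-map-allFin h = cong (foldr _⊔_ 0) (map-tabulate (λ x → x) h)

module _ {n} (d : Dist n) where

  ≤-ecc : ∀ u v → d u v ≤ ecc d v
  ≤-ecc u v = subst (d u v ≤_) (sym (max-map-allFin (λ w → d w v))) (≤-max-tabulate (λ w → d w v) u)

  ecc-≤ : ∀ v {b} → (∀ u → d u v ≤ b) → ecc d v ≤ b
  ecc-≤ v du≤b = subst (_≤ _) (sym (max-map-allFin (λ w → d w v))) (max-tabulate-≤ (λ w → d w v) du≤b)

  ecc≤diam : ∀ v → ecc d v ≤ diam d
  ecc≤diam v = subst (ecc d v ≤_) (sym (max-map-allFin (ecc d))) (≤-max-tabulate (ecc d) v)

  inH? : ∀ f u v → Dec (InH d f u v)
  inH? f u v = (0 <? f v) ×-dec (d u v ≤? f v)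

  -- Raising f v by one would make some vertex hear two broadcasts.
  Blocked : (Fin n → ℕ) → Fin n → Set
  Blocked f v = ∃ λ x → d x v ≤ suc (f v) × ∃ λ z → InH d f x z × ¬ z ≡ v

  blocked? : ∀ f v → Dec (Blocked f v)
  blocked? f v = any? (λ x → (d x v ≤? suc (f v)) ×-dec any? (λ z → inH? f x z ×-dec ¬? (z Fin.≟ v)))

  InH-mono : ∀ {f g} → (∀ v → f v ≤ g v) → ∀ {u v} → InH d f u v → InH d g u v
  InH-mono f≤g {v = v} (f>0 , du≤f) = ≤-trans f>0 (f≤g v) , ≤-trans du≤f (f≤g v)

  module Raise (f : Fin n → ℕ) (v : Fin n) where

    raise : Fin n → ℕ
    raise w with w Fin.≟ v
    ... | yes _ = suc (f w)
    ... | no  _ = f w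

    raise-at : raise v ≡ suc (f v)
    raise-at with v Fin.≟ v
    ... | yes _  = refl
    ... | no v≢v = ⊥-elim (v≢v refl)

    raise-≤ : ∀ {b : Fin n → ℕ} → f v < b v → (∀ w → f w ≤ b w) → ∀ w → raise w ≤ b w
    raise-≤ f<b f≤b w with w Fin.≟ v
    ... | yes refl = f<b
    ... | no  _    = f≤b w

    f≤raise : ∀ w → f w ≤ raise w
    f≤raise w with w Fin.≟ v
    ... | yes _ = n≤1+n _
    ... | no  _ = ≤-refl

    InH-raise : ∀ {x w} → InH d raise x w → (w ≡ v × d x v ≤ suc (f v)) ⊎ (¬ w ≡ v × InH d f x w)
    InH-raise {w = w} h with w Fin.≟ v
    ... | yes refl = inj₁ (refl , proj₂ h)
    ... | no  w≢v  = inj₂ (w≢v , h)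

  maximal⇒blocked : ∀ {f} → IsMaximalPacking d f → ∀ v → f v < ecc d v → Blocked f v
  maximal⇒blocked {f} ((broadcast , packing) , maximal) v f<ecc with blocked? f v
  ... | yes blocked = blocked
  ... | no unblocked = ⊥-elim (1+n≢n (trans (sym raise-at) (maximal raise (isBroadcast , isPacking) f≤raise v)))
    where
    open Raise f v
    isBroadcast : IsBroadcast d raise
    isBroadcast w = raise-≤ (≤-trans f<ecc (ecc≤diam v)) (λ u → proj₁ (broadcast u)) w ,
                    raise-≤ f<ecc (λ u → proj₂ (broadcast u)) w
    isPacking : ∀ x y w → InH d raise x y → InH d raise x w → y ≡ w
    isPacking x y w hy hw with InH-raise hy | InH-raise hw
    ... | inj₁ (y≡v , _)    | inj₁ (w≡v , _)    = trans y≡v (sym w≡v)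
    ... | inj₁ (_ , near)   | inj₂ (w≢v , hw′)  = ⊥-elim (unblocked (x , near , w , hw′ , w≢v))
    ... | inj₂ (y≢v , hy′)  | inj₁ (_ , near)   = ⊥-elim (unblocked (x , near , y , hy′ , y≢v))
    ... | inj₂ (_ , hy′)    | inj₂ (_ , hw′)    = packing x y w hy′ hw′

  blocked⇒maximal : ∀ {f} → IsPackingBroadcast d f → (∀ v → f v < ecc d v → Blocked f v) → IsMaximalPacking d f
  blocked⇒maximal {f} isPacking blocked = isPacking , maximal
    where
    maximal : ∀ g → IsPackingBroadcast d g → (∀ v → f v ≤ g v) → ∀ v → g v ≡ f v
    maximal g (g-broadcast , g-packing) f≤g v with g v ≤? f v
    ... | yes g≤f = ≤-antisym g≤f (f≤g v)
    ... | no  g≰f with blocked v (<-≤-trans (≰⇒> g≰f) (proj₂ (g-broadcast v)))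
    ...   | x , dxv≤1+f , z , x-hears-z , z≢v =
      ⊥-elim (z≢v (g-packing x z v (InH-mono f≤g x-hears-z) (≤-trans (s≤s z≤n) f<g , ≤-trans dxv≤1+f f<g)))
      where
      f<g : f v < g v
      f<g = ≰⇒> g≰f

pathEcc : ℕ → ℕ → ℕ
pathEcc n v = v ⊔ (n ∸ 1 ∸ v)

n≤1+2*pathEcc : ∀ n v → n ≤ suc (pathEcc n v + pathEcc n v)
n≤1+2*pathEcc n v = ≤-trans (m≤n+m∸n n 1) (s≤s (≤-trans (m≤n+m∸n (n ∸ 1) v)
  (+-mono-≤ (m≤m⊔n v _) (m≤n⊔m v _))))

1≤pathEcc : ∀ {n} → 2 ≤ n → ∀ v → 1 ≤ pathEcc n v
1≤pathEcc {n} 2≤n zero    = ≤-trans (∸-monoˡ-≤ 1 2≤n) (m≤n⊔m 0 (n ∸ 1))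
1≤pathEcc {n} 2≤n (suc v) = ≤-trans (s≤s z≤n) (m≤m⊔n (suc v) (n ∸ 1 ∸ suc v))

module Path (n : ℕ) (F : ℕ → ℕ) where

  Hears : ℕ → ℕ → Set
  Hears u v = 0 < F v × ∣ u - v ∣ ≤ F v

  hears? : ∀ u v → Dec (Hears u v)
  hears? u v = (0 <? F v) ×-dec (∣ u - v ∣ ≤? F v)

  Covered : ℕ → Set
  Covered u = ∃ λ v → v < n × Hears u v

  covered? : ∀ u → Dec (Covered u)
  covered? u = anyUpTo? (hears? u) n

  Packing : Set
  Packing = ∀ {u v w} → u < n → v < n → w < n → Hears u v → Hears u w → v ≡ w

  BlockedAt : ℕ → Set
  BlockedAt v = ∃ λ x → x < n × ∣ x - v ∣ ≤ suc (F v) × ∃ λ z → z < n × Hears x z × ¬ z ≡ v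

  record MaximalPacking : Set where
    field
      packing : Packing
      bounded : ∀ v → v < n → F v ≤ pathEcc n v
      blocked : ∀ v → v < n → F v < pathEcc n v → BlockedAt v

  BlockedLeft BlockedRight : ℕ → Set
  BlockedLeft  v = F v < v × Covered (v ∸ suc (F v))
  BlockedRight v = v + suc (F v) < n × Covered (v + suc (F v))

  hears-self : ∀ {v} → 0 < F v → Hears v v
  hears-self {v} F>0 = F>0 , ≤-trans (≤-reflexive (∣n-n∣≡0 v)) z≤n

  module _ (mp : MaximalPacking) where
    open MaximalPacking mp

    silent-if-uncovered : ∀ {u} → u < n → ¬ Covered u → F u ≡ 0
    silent-if-uncovered {u} u<n uncovered with 0 <? F u
    ... | yes F>0 = ⊥-elim (uncovered (u , u<n , hears-self F>0))
    ... | no  F≯0 = n≤0⇒n≡0 (≮⇒≥ F≯0)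

    blocked-side : ∀ {v} → v < n → 0 < F v → F v < pathEcc n v → BlockedLeft v ⊎ BlockedRight v
    blocked-side {v} v<n F>0 F<ecc with blocked v v<n F<ecc
    ... | x , x<n , dxv≤1+F , z , z<n , x-hears-z , z≢v with m≤n⇒m<n∨m≡n dxv≤1+F
    ...   | inj₁ dxv≤F = ⊥-elim (z≢v (packing x<n z<n v<n x-hears-z (F>0 , ≤-pred dxv≤F)))
    ...   | inj₂ dxv≡1+F with ∣m-n∣≡o⇒m+o≡n⊎m≡n+o x v (suc (F v)) dxv≡1+F
    ...     | inj₁ x+1+F≡v = inj₁ (F<v , subst Covered x≡v-1-F (z , z<n , x-hears-z))
      where
      F<v : F v < v
      F<v = ≤-trans (s≤s (m≤n+m (F v) x)) (≤-reflexive (trans (sym (+-suc x (F v))) x+1+F≡v))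
      x≡v-1-F : x ≡ v ∸ suc (F v)
      x≡v-1-F = trans (sym (m+n∸n≡m x (suc (F v)))) (cong (_∸ suc (F v)) x+1+F≡v)
    ...     | inj₂ x≡v+1+F = inj₂ (subst (_< n) x≡v+1+F x<n , subst Covered x≡v+1+F (z , z<n , x-hears-z))

  module Counting (2≤n : 2 ≤ n) (mp : MaximalPacking) where
    open MaximalPacking mp

    Owns : ℕ → ℕ → Set
    Owns v u = v < n × 0 < F v × ∣ u - v ∣ ≤ suc (F v) × (∣ u - v ∣ ≡ suc (F v) → ¬ Covered u)

    owns? : ∀ v u → Dec (Owns v u)
    owns? v u = (v <? n) ×-dec (0 <? F v) ×-dec (∣ u - v ∣ ≤? suc (F v)) ×-dec
                ((∣ u - v ∣ ≟ suc (F v)) →-dec ¬? (covered? u))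

    ownedCount : ℕ → ℕ
    ownedCount v = ∑ n (λ u → indicator (owns? v u))

    owner : ∀ u → u < n → ∃ λ v → Owns v u
    owner u u<n with covered? u
    ... | yes (v , v<n , F>0 , duv≤F) =
      v , v<n , F>0 , m≤n⇒m≤1+n duv≤F , λ duv≡1+F → ⊥-elim (1+n≰n (subst (_≤ F v) duv≡1+F duv≤F))
    ... | no uncovered
      with blocked u u<n (subst (_< pathEcc n u) (sym (silent-if-uncovered mp u<n uncovered)) (1≤pathEcc 2≤n u))
    ...   | x , _ , dxu≤1+F , z , z<n , (F>0 , dxz≤F) , _ = z , z<n , F>0 , duz≤1+F , λ _ → uncovered
      where
      dux≤1 : ∣ u - x ∣ ≤ 1
      dux≤1 = subst₂ _≤_ (∣-∣-comm x u) (cong suc (silent-if-uncovered mp u<n uncovered)) dxu≤1+F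
      duz≤1+F : ∣ u - z ∣ ≤ suc (F z)
      duz≤1+F = ≤-trans (∣-∣-triangle u x z) (+-mono-≤ dux≤1 dxz≤F)

    n≤∑ownedCount : n ≤ ∑ n ownedCount
    n≤∑ownedCount = begin
      n                                               ≡⟨ ∑-one n ⟨
      ∑ n (λ _ → 1)                                   ≤⟨ ∑-mono-≤ n owned-at-least-once ⟩
      ∑ n (λ u → ∑ n (λ v → indicator (owns? v u)))   ≡⟨ ∑-comm n n (λ u v → indicator (owns? v u)) ⟩
      ∑ n ownedCount                                  ∎
      where
      open ≤-Reasoning
      owned-at-least-once : ∀ u → u < n → 1 ≤ ∑ n (λ v → indicator (owns? v u))
      owned-at-least-once u u<n with owner u u<n
      ... | v , owns = ≤-trans (≤-reflexive (sym (indicator-yes (owns? v u) owns))) (≤-∑ n _ (proj₁ owns))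

    ownedCount≤n : ∀ v → ownedCount v ≤ n
    ownedCount≤n v = ≤-trans (∑-mono-≤ n (λ u _ → indicator≤1 (owns? v u))) (≤-reflexive (∑-one n))

    ownedCount-silent : ∀ {v} → F v ≡ 0 → ownedCount v ≡ 0
    ownedCount-silent {v} F≡0 =
      trans (∑-cong n (λ u _ → indicator-no (owns? v u) (λ owns → <-irrefl (sym F≡0) (proj₁ (proj₂ owns))))) (∑-zero n)

    ownedCount-within : ∀ v c d → (∀ u → Owns v u → v ≤ u + c × u ≤ v + d) → ownedCount v ≤ suc (c + d)
    ownedCount-within v c d within = ∑-≤-support n _ (v ∸ c) (suc (c + d)) (λ u → indicator≤1 (owns? v u)) support
      where
      support : ∀ u → 0 < indicator (owns? v u) → v ∸ c ≤ u × u < v ∸ c + suc (c + d)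
      support u owned with within u (indicator>0⇒ (owns? v u) owned)
      ... | v≤u+c , u≤v+d = m≤n+o⇒m∸n≤o v c (≤-trans v≤u+c (≤-reflexive (+-comm u c))) ,
        ≤-trans (s≤s (begin
        u                    ≤⟨ u≤v+d ⟩
        v + d                ≤⟨ +-monoˡ-≤ d (m≤n+m∸n v c) ⟩
        c + (v ∸ c) + d      ≡⟨ regroup c (v ∸ c) d ⟩
        v ∸ c + (c + d)      ∎)) (≤-reflexive (sym (+-suc (v ∸ c) (c + d))))
        where
        open ≤-Reasoning
        regroup : ∀ a b e → a + b + e ≡ b + (a + e)
        regroup = solve-∀

    owns⇒near : ∀ {v u} → Owns v u → v ≤ u + suc (F v) × u ≤ v + suc (F v)
    owns⇒near {v} {u} (_ , _ , duv≤1+F , _) =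
      ∣m-n∣≤o⇒m≤n+o v u _ (subst (_≤ suc (F v)) (∣-∣-comm u v) duv≤1+F) , ∣m-n∣≤o⇒m≤n+o u v _ duv≤1+F

    owns⇒near-blockedLeft : ∀ {v u} → BlockedLeft v → Owns v u → v ≤ u + F v
    owns⇒near-blockedLeft {v} {u} (F<v , covered) owns@(_ , _ , _ , at-edge⇒uncovered)
      with m≤n⇒m<n∨m≡n (proj₁ (owns⇒near owns))
    ... | inj₁ v<u+1+F = ≤-pred (≤-trans v<u+1+F (≤-reflexive (+-suc u (F v))))
    ... | inj₂ v≡u+1+F = ⊥-elim (at-edge⇒uncovered duv≡1+F (subst Covered u≡v-1-F covered))
      where
      duv≡1+F : ∣ u - v ∣ ≡ suc (F v)
      duv≡1+F = trans (cong (λ x → ∣ u - x ∣) v≡u+1+F) (∣m-m+n∣≡n u (suc (F v)))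
      u≡v-1-F : v ∸ suc (F v) ≡ u
      u≡v-1-F = trans (cong (_∸ suc (F v)) v≡u+1+F) (m+n∸n≡m u (suc (F v)))

    owns⇒near-blockedRight : ∀ {v u} → BlockedRight v → Owns v u → u ≤ v + F v
    owns⇒near-blockedRight {v} {u} (_ , covered) owns@(_ , _ , _ , at-edge⇒uncovered)
      with m≤n⇒m<n∨m≡n (proj₂ (owns⇒near owns))
    ... | inj₁ u<v+1+F = ≤-pred (≤-trans u<v+1+F (≤-reflexive (+-suc v (F v))))
    ... | inj₂ u≡v+1+F = ⊥-elim (at-edge⇒uncovered duv≡1+F (subst Covered (sym u≡v+1+F) covered))
      where
      duv≡1+F : ∣ u - v ∣ ≡ suc (F v)
      duv≡1+F = trans (cong (λ x → ∣ x - v ∣) u≡v+1+F) (∣m+n-m∣≡n v (suc (F v)))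

    ownedCount-blockedLeft : ∀ {v} → BlockedLeft v → ownedCount v ≤ suc (F v + suc (F v))
    ownedCount-blockedLeft {v} left =
      ownedCount-within v (F v) (suc (F v)) (λ u owns → owns⇒near-blockedLeft left owns , proj₂ (owns⇒near owns))

    ownedCount-blockedRight : ∀ {v} → BlockedRight v → ownedCount v ≤ suc (F v + suc (F v))
    ownedCount-blockedRight {v} right = ≤-trans
      (ownedCount-within v (suc (F v)) (F v) (λ u owns → proj₁ (owns⇒near owns) , owns⇒near-blockedRight right owns))
      (≤-reflexive (cong suc (+-comm (suc (F v)) (F v))))

    ownedCount-blockedBoth : ∀ {v} → BlockedLeft v → BlockedRight v → ownedCount v ≤ suc (F v + F v)
    ownedCount-blockedBoth {v} left right =
      ownedCount-within v (F v) (F v) (λ u owns → owns⇒near-blockedLeft left owns , owns⇒near-blockedRight right owns)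

    ownedCount-reachingEnds : ∀ {v} → pathEcc n v ≤ F v → ownedCount v ≤ suc (F v + F v)
    ownedCount-reachingEnds {v} ecc≤F =
      ≤-trans (ownedCount≤n v) (≤-trans (n≤1+2*pathEcc n v) (s≤s (+-mono-≤ ecc≤F ecc≤F)))

    ownedCount≤4F : ∀ v → v < n → ownedCount v ≤ 4 * F v
    ownedCount≤4F v v<n with F v ≟ 0
    ... | yes F≡0 = ≤-trans (≤-reflexive (ownedCount-silent F≡0)) z≤n
    ... | no  F≢0 with n≢0⇒n>0 F≢0 | pathEcc n v ≤? F v
    ...   | F>0 | yes ecc≤F =
      ≤-trans (ownedCount-reachingEnds ecc≤F) (≤-trans (s≤s (+-monoʳ-≤ (F v) (n≤1+n _))) (1+k+1+k≤4k (F v) F>0))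
    ...   | F>0 | no  ecc≰F with blocked-side mp v<n F>0 (≰⇒> ecc≰F)
    ...     | inj₁ left  = ≤-trans (ownedCount-blockedLeft left) (1+k+1+k≤4k (F v) F>0)
    ...     | inj₂ right = ≤-trans (ownedCount-blockedRight right) (1+k+1+k≤4k (F v) F>0)

    n≤4∑F : n ≤ 4 * ∑ n F
    n≤4∑F = ≤-trans n≤∑ownedCount (≤-trans (∑-mono-≤ n ownedCount≤4F) (≤-reflexive (∑-distribˡ-* n 4 F)))

    module Tight (4∑F≡n : 4 * ∑ n F ≡ n) where

      ownedCount≡4F : ∀ v → v < n → ownedCount v ≡ 4 * F v
      ownedCount≡4F = ∑-mono-≤-tight n ownedCount≤4F
        (≤-trans (≤-reflexive (trans (∑-distribˡ-* n 4 F) 4∑F≡n)) n≤∑ownedCount)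

      4F≤ownedCount : ∀ {v} → v < n → 4 * F v ≤ ownedCount v
      4F≤ownedCount v<n = ≤-reflexive (sym (ownedCount≡4F _ v<n))

      never-reaches-ends : ∀ {v} → v < n → 0 < F v → F v < pathEcc n v
      never-reaches-ends {v} v<n F>0 = ≰⇒> λ ecc≤F →
        4k≰1+k+k (F v) F>0 (≤-trans (4F≤ownedCount v<n) (ownedCount-reachingEnds ecc≤F))

      never-blocked-both : ∀ {v} → v < n → 0 < F v → ¬ (BlockedLeft v × BlockedRight v)
      never-blocked-both {v} v<n F>0 (left , right) =
        4k≰1+k+k (F v) F>0 (≤-trans (4F≤ownedCount v<n) (ownedCount-blockedBoth left right))

      broadcasts-one : ∀ {v} → v < n → 0 < F v → F v ≡ 1
      broadcasts-one {v} v<n F>0 = ≤-antisym (4k≤1+k+1+k⇒k≤1 (F v) (≤-trans (4F≤ownedCount v<n) side-bound)) F>0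
        where
        side-bound : ownedCount v ≤ suc (F v + suc (F v))
        side-bound with blocked-side mp v<n F>0 (never-reaches-ends v<n F>0)
        ... | inj₁ left  = ownedCount-blockedLeft left
        ... | inj₂ right = ownedCount-blockedRight right

      hears-broadcaster : ∀ {v} u → v < n → 0 < F v → ∣ u - v ∣ ≤ 1 → Hears u v
      hears-broadcaster _ v<n F>0 duv≤1 = F>0 , subst (_ ≤_) (sym (broadcasts-one v<n F>0)) duv≤1

      broadcasters-spaced : ∀ v k → k ≤ 1 → v + suc k < n → 0 < F v → 0 < F (v + suc k) → ⊥
      broadcasters-spaced v k k≤1 v+1+k<n Fv>0 Fw>0 = m≢1+m+n v (trans v≡v+1+k (+-suc v k))
        where
        v<n : v < n
        v<n = <-trans (m<m+n v (s≤s z≤n)) v+1+k<n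
        v+1<n : v + 1 < n
        v+1<n = ≤-<-trans (+-monoʳ-≤ v (s≤s z≤n)) v+1+k<n
        d : ∣ v + 1 - v + suc k ∣ ≡ k
        d = trans (∣m+n-m+o∣≡∣n-o∣ v 1 (suc k)) (∣-∣-identityˡ k)
        v≡v+1+k : v ≡ v + suc k
        v≡v+1+k = packing v+1<n v<n v+1+k<n
          (hears-broadcaster (v + 1) v<n Fv>0 (≤-reflexive (∣m+n-m∣≡n v 1)))
          (hears-broadcaster (v + 1) v+1+k<n Fw>0 (≤-trans (≤-reflexive d) k≤1))

      LeftBroadcaster RightBroadcaster : ℕ → Set
      LeftBroadcaster  v = v < n × 0 < F v × BlockedLeft v
      RightBroadcaster v = v < n × 0 < F v × BlockedRight v

      leftBroadcaster? : ∀ v → Dec (LeftBroadcaster v)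
      leftBroadcaster? v = (v <? n) ×-dec (0 <? F v) ×-dec ((F v <? v) ×-dec covered? (v ∸ suc (F v)))

      rightBroadcaster? : ∀ v → Dec (RightBroadcaster v)
      rightBroadcaster? v = (v <? n) ×-dec (0 <? F v) ×-dec ((v + suc (F v) <? n) ×-dec covered? (v + suc (F v)))

      facing : ∀ w → w < n → 0 < F w → 3 + w < n → 0 < F (3 + w) → RightBroadcaster w × LeftBroadcaster (3 + w)
      facing w w<n Fw>0 3+w<n F3+w>0 =
        (w<n , Fw>0 , subst (λ k → w + suc k < n) (sym Fw≡1) w+2<n ,
          subst (λ k → Covered (w + suc k)) (sym Fw≡1) (3 + w , 3+w<n , hears-broadcaster (w + 2) 3+w<n F3+w>0 (≤-reflexive dw+2)))
        , (3+w<n , F3+w>0 , subst (_< 3 + w) (sym F3+w≡1) (s≤s (s≤s z≤n)) ,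
          subst (λ k → Covered (3 + w ∸ suc k)) (sym F3+w≡1)
            (w , w<n , hears-broadcaster (suc w) w<n Fw>0 (≤-reflexive (∣1+m-m∣≡1 w))))
        where
        Fw≡1 : F w ≡ 1
        Fw≡1 = broadcasts-one w<n Fw>0
        F3+w≡1 : F (3 + w) ≡ 1
        F3+w≡1 = broadcasts-one 3+w<n F3+w>0
        w+2<n : w + 2 < n
        w+2<n = subst (_< n) (sym (+-comm w 2)) (<-trans (n<1+n (2 + w)) 3+w<n)
        dw+2 : ∣ w + 2 - 3 + w ∣ ≡ 1
        dw+2 = trans (cong (λ x → ∣ x - 3 + w ∣) (+-comm w 2)) (∣m-1+m∣≡1 (2 + w))

      right⇒left : ∀ w → RightBroadcaster w → LeftBroadcaster (3 + w)
      right⇒left w (w<n , Fw>0 , _ , z , z<n , Fz>0 , dz≤Fz) with ∣m-n∣≤1⇒n≡m⊎n≡1+m⊎m≡1+n (w + 2) z dz≤1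
        where
        dz≤1 : ∣ w + 2 - z ∣ ≤ 1
        dz≤1 = subst₂ (λ a b → ∣ w + suc a - z ∣ ≤ b) (broadcasts-one w<n Fw>0) (broadcasts-one z<n Fz>0) dz≤Fz
      ... | inj₁ z≡w+2 =
        ⊥-elim (broadcasters-spaced w 1 ≤-refl (subst (_< n) z≡w+2 z<n) Fw>0 (subst (λ x → 0 < F x) z≡w+2 Fz>0))
      ... | inj₂ (inj₁ z≡w+3) =
        proj₂ (facing w w<n Fw>0 (subst (_< n) z≡3+w z<n) (subst (λ x → 0 < F x) z≡3+w Fz>0))
        where
        z≡3+w : z ≡ 3 + w
        z≡3+w = trans z≡w+3 (cong suc (+-comm w 2))
      ... | inj₂ (inj₂ w+2≡1+z) =
        ⊥-elim (broadcasters-spaced w 0 z≤n (subst (_< n) z≡w+1 z<n) Fw>0 (subst (λ x → 0 < F x) z≡w+1 Fz>0))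
        where
        z≡w+1 : z ≡ w + 1
        z≡w+1 = suc-injective (trans (sym w+2≡1+z) (+-suc w 1))

      left⇒right : ∀ v → LeftBroadcaster v → ∃ λ w → v ≡ 3 + w × RightBroadcaster w
      left⇒right zero          (_ , _ , F<0 , _)       = ⊥-elim (n≮0 F<0)
      left⇒right (suc zero)    (_ , F>0 , F<1 , _)     = ⊥-elim (<⇒≱ F<1 F>0)
      left⇒right (suc (suc y)) (v<n , Fv>0 , _ , z , z<n , Fz>0 , dz≤Fz) with ∣m-n∣≤1⇒n≡m⊎n≡1+m⊎m≡1+n y z dz≤1
        where
        dz≤1 : ∣ y - z ∣ ≤ 1
        dz≤1 = subst₂ (λ a b → ∣ suc (suc y) ∸ suc a - z ∣ ≤ b) (broadcasts-one v<n Fv>0) (broadcasts-one z<n Fz>0) dz≤Fz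
      ... | inj₁ z≡y =
        ⊥-elim (broadcasters-spaced y 1 ≤-refl (subst (_< n) v≡y+2 v<n)
          (subst (λ x → 0 < F x) z≡y Fz>0) (subst (λ x → 0 < F x) v≡y+2 Fv>0))
        where
        v≡y+2 : suc (suc y) ≡ y + 2
        v≡y+2 = +-comm 2 y
      ... | inj₂ (inj₁ z≡1+y) =
        ⊥-elim (broadcasters-spaced z 0 z≤n (subst (_< n) v≡z+1 v<n) Fz>0 (subst (λ x → 0 < F x) v≡z+1 Fv>0))
        where
        v≡z+1 : suc (suc y) ≡ z + 1
        v≡z+1 = trans (cong suc (sym z≡1+y)) (+-comm 1 z)
      ... | inj₂ (inj₂ refl) =
        z , refl , proj₁ (facing z z<n Fz>0 v<n Fv>0)

      F≡left+right : ∀ v → v < n → F v ≡ indicator (leftBroadcaster? v) + indicator (rightBroadcaster? v)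
      F≡left+right v v<n with F v ≟ 0
      ... | yes F≡0 = trans F≡0 (sym (cong₂ _+_
              (indicator-no (leftBroadcaster? v) (silent ∘ proj₁ ∘ proj₂))
              (indicator-no (rightBroadcaster? v) (silent ∘ proj₁ ∘ proj₂))))
        where
        silent : ¬ 0 < F v
        silent F>0 = <-irrefl (sym F≡0) F>0
      ... | no F≢0 with n≢0⇒n>0 F≢0
      ...   | F>0 with blocked-side mp v<n F>0 (never-reaches-ends v<n F>0)
      ...     | inj₁ left  = trans (broadcasts-one v<n F>0) (sym (cong₂ _+_
                  (indicator-yes (leftBroadcaster? v) (v<n , F>0 , left))
                  (indicator-no (rightBroadcaster? v) (λ r → never-blocked-both v<n F>0 (left , proj₂ (proj₂ r))))))
      ...     | inj₂ right = trans (broadcasts-one v<n F>0) (sym (cong₂ _+_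
                  (indicator-no (leftBroadcaster? v) (λ l → never-blocked-both v<n F>0 (proj₂ (proj₂ l) , right)))
                  (indicator-yes (rightBroadcaster? v) (v<n , F>0 , right))))

      #left≡#right : ∑ n (λ v → indicator (leftBroadcaster? v)) ≡ ∑ n (λ w → indicator (rightBroadcaster? w))
      #left≡#right = begin
        ∑ n left                             ≡⟨ ∑-vanishing-tail n 3 left none-beyond-n ⟨
        ∑ (n + 3) left                       ≡⟨ cong (λ m → ∑ m left) (+-comm n 3) ⟩
        ∑ (3 + n) left                       ≡⟨ ∑-+ 3 n left ⟩
        ∑ 3 left + ∑ n (λ w → left (3 + w))  ≡⟨ cong (_+ ∑ n (λ w → left (3 + w))) none-below-3 ⟩
        ∑ n (λ w → left (3 + w))             ≡⟨ ∑-cong n (λ w _ → shifted w) ⟩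
        ∑ n (λ w → indicator (rightBroadcaster? w))  ∎
        where
        open ≡-Reasoning
        left : ℕ → ℕ
        left v = indicator (leftBroadcaster? v)
        none-beyond-n : ∀ v → n ≤ v → left v ≡ 0
        none-beyond-n v n≤v = indicator-no (leftBroadcaster? v) (λ l → <⇒≱ (proj₁ l) n≤v)
        none-below-3 : ∑ 3 left ≡ 0
        none-below-3 =
          trans (∑-cong 3 (λ v v<3 → indicator-no (leftBroadcaster? v) (at-least-3 v<3 ∘ left⇒right v))) (∑-zero 3)
          where
          at-least-3 : ∀ {v} → v < 3 → ¬ ∃ λ w → v ≡ 3 + w × RightBroadcaster w
          at-least-3 v<3 (w , refl , _) = <⇒≱ v<3 (m≤m+n 3 w)
        shift-back : ∀ w → LeftBroadcaster (3 + w) → RightBroadcaster w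
        shift-back w l with left⇒right (3 + w) l
        ... | w′ , 3+w≡3+w′ , r = subst RightBroadcaster (sym (+-cancelˡ-≡ 3 w w′ 3+w≡3+w′)) r
        shifted : ∀ w → left (3 + w) ≡ indicator (rightBroadcaster? w)
        shifted w = indicator-cong (leftBroadcaster? (3 + w)) (rightBroadcaster? w) (shift-back w) (right⇒left w)

      ∑F-even : ∃ λ t → ∑ n F ≡ t + t
      ∑F-even = ∑ n (λ v → indicator (leftBroadcaster? v)) , (begin
        ∑ n F                                     ≡⟨ ∑-cong n F≡left+right ⟩
        ∑ n (λ v → indicator (leftBroadcaster? v) + indicator (rightBroadcaster? v))
                                                  ≡⟨ ∑-distrib-+ n _ _ ⟩
        ∑ n (λ v → indicator (leftBroadcaster? v)) + ∑ n (λ v → indicator (rightBroadcaster? v))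
                                                  ≡⟨ cong (∑ n (λ v → indicator (leftBroadcaster? v)) +_) #left≡#right ⟨
        ∑ n (λ v → indicator (leftBroadcaster? v)) + ∑ n (λ v → indicator (leftBroadcaster? v)) ∎)
        where open ≡-Reasoning

odd≢even : ∀ t s → 2 * t + 1 ≢ s + s
odd≢even t s 2t+1≡s+s = 0≢1+n (begin
  0                  ≡⟨ m*n%n≡0 s 2 ⟨
  (s * 2) % 2        ≡⟨ cong (_% 2) (trans (s*2≡s+s s) (sym 2t+1≡s+s)) ⟩
  (2 * t + 1) % 2    ≡⟨ cong (_% 2) (2t+1≡1+t*2 t) ⟩
  (1 + t * 2) % 2    ≡⟨ [m+kn]%n≡m%n 1 t 2 ⟩
  1                  ∎)
  where
  open ≡-Reasoning
  s*2≡s+s : ∀ s → s * 2 ≡ s + s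
  s*2≡s+s = solve-∀
  2t+1≡1+t*2 : ∀ t → 2 * t + 1 ≡ 1 + t * 2
  2t+1≡1+t*2 = solve-∀

4k+r≤4σ⇒k<σ : ∀ k r σ → 0 < r → 4 * k + r ≤ 4 * σ → k < σ
4k+r≤4σ⇒k<σ k r σ r>0 ≤4σ = *-cancelˡ-< 4 k σ (<-≤-trans (m<m+n (4 * k) r>0) ≤4σ)

4+t*8≡4*[2t+1] : ∀ t → 4 + t * 8 ≡ 4 * (2 * t + 1)
4+t*8≡4*[2t+1] = solve-∀

module _ (σ t : ℕ) where

  residue0 : t * 8 ≤ 4 * σ → (t * 8) / 4 ≤ σ
  residue0 n≤4σ = subst (_≤ σ) (sym [t*8]/4≡t*2) (*-cancelˡ-≤ 4 (subst (_≤ 4 * σ) (t*8≡4*[t*2] t) n≤4σ))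
    where
    t*8≡4*[t*2] : ∀ t → t * 8 ≡ 4 * (t * 2)
    t*8≡4*[t*2] = solve-∀
    [t*8]/4≡t*2 : (t * 8) / 4 ≡ t * 2
    [t*8]/4≡t*2 = trans (cong (_/ 4) (trans (t*8≡4*[t*2] t) (*-comm 4 (t * 2)))) (m*n/n≡m (t * 2) 4)

  residue1-3 : ∀ r → 0 < r → r + t * 8 ≤ 4 * σ → 2 * t + 1 ≤ σ
  residue1-3 r r>0 n≤4σ = subst (_≤ σ) (+-comm 1 (2 * t))
    (4k+r≤4σ⇒k<σ (2 * t) r σ r>0 (subst (_≤ 4 * σ) (r+t*8≡4*[2t]+r r t) n≤4σ))
    where
    r+t*8≡4*[2t]+r : ∀ r t → r + t * 8 ≡ 4 * (2 * t) + r
    r+t*8≡4*[2t]+r = solve-∀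

  residue4 : 4 + t * 8 ≤ 4 * σ → (4 * σ ≡ 4 + t * 8 → ∃ λ s → σ ≡ s + s) → 2 * t + 2 ≤ σ
  residue4 n≤4σ even with m≤n⇒m<n∨m≡n (*-cancelˡ-≤ 4 (subst (_≤ 4 * σ) (4+t*8≡4*[2t+1] t) n≤4σ))
  ... | inj₁ 2t+1<σ = subst (_≤ σ) (sym (+-suc (2 * t) 1)) 2t+1<σ
  ... | inj₂ 2t+1≡σ with even (trans (cong (4 *_) (sym 2t+1≡σ)) (sym (4+t*8≡4*[2t+1] t)))
  ...   | s , σ≡s+s = ⊥-elim (odd≢even t s (trans 2t+1≡σ σ≡s+s))

  residue5-7 : ∀ r → 0 < r → (4 + r) + t * 8 ≤ 4 * σ → 2 * t + 2 ≤ σ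
  residue5-7 r r>0 n≤4σ = subst (_≤ σ) (sym (+-suc (2 * t) 1))
    (4k+r≤4σ⇒k<σ (2 * t + 1) r σ r>0 (subst (_≤ 4 * σ) (4+r+t*8≡4*[2t+1]+r r t) n≤4σ))
    where
    4+r+t*8≡4*[2t+1]+r : ∀ r t → 4 + r + t * 8 ≡ 4 * (2 * t + 1) + r
    4+r+t*8≡4*[2t+1]+r = solve-∀

pbPathValue-least : ∀ n σ → n ≤ 4 * σ → (4 * σ ≡ n → ∃ λ t → σ ≡ t + t) → pbPathValue n ≤ σ
pbPathValue-least n σ n≤4σ even with n % 8 | m≡m%n+[m/n]*n n 8 | m%n<n n 8
... | 0 | n≡ | _ = subst (λ m → m / 4 ≤ σ) (sym n≡) (residue0 σ (n / 8) (subst (_≤ 4 * σ) n≡ n≤4σ))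
... | 1 | n≡ | _ = residue1-3 σ (n / 8) 1 (s≤s z≤n) (subst (_≤ 4 * σ) n≡ n≤4σ)
... | 2 | n≡ | _ = residue1-3 σ (n / 8) 2 (s≤s z≤n) (subst (_≤ 4 * σ) n≡ n≤4σ)
... | 3 | n≡ | _ = residue1-3 σ (n / 8) 3 (s≤s z≤n) (subst (_≤ 4 * σ) n≡ n≤4σ)
... | 4 | n≡ | _ = residue4 σ (n / 8) (subst (_≤ 4 * σ) n≡ n≤4σ) (λ 4σ≡ → even (trans 4σ≡ (sym n≡)))
... | 5 | n≡ | _ = residue5-7 σ (n / 8) 1 (s≤s z≤n) (subst (_≤ 4 * σ) n≡ n≤4σ)
... | 6 | n≡ | _ = residue5-7 σ (n / 8) 2 (s≤s z≤n) (subst (_≤ 4 * σ) n≡ n≤4σ)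
... | 7 | n≡ | _ = residue5-7 σ (n / 8) 3 (s≤s z≤n) (subst (_≤ 4 * σ) n≡ n≤4σ)
... | suc (suc (suc (suc (suc (suc (suc (suc _))))))) | _ | s≤s (s≤s (s≤s (s≤s (s≤s (s≤s (s≤s (s≤s ())))))))

pbPathValue≤∑ : ∀ n F → 2 ≤ n → Path.MaximalPacking n F → pbPathValue n ≤ ∑ n F
pbPathValue≤∑ n F 2≤n mp = pbPathValue-least n (∑ n F) n≤4∑F Tight.∑F-even
  where open Path.Counting n F 2≤n mp

ecc-pathDist : ∀ {n} (v : Fin n) → ecc (pathDist n) v ≡ pathEcc n (toℕ v)
ecc-pathDist {suc m} v = ≤-antisym (ecc-≤ (pathDist (suc m)) v dist≤) (⊔-lub (≤-ecc (pathDist (suc m)) Fin.zero v) m-v≤ecc)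
  where
  dist≤ : ∀ u → ∣ toℕ u - toℕ v ∣ ≤ toℕ v ⊔ (m ∸ toℕ v)
  dist≤ u with ∣m-n∣≡[m∸n]∨[n∸m] (toℕ u) (toℕ v)
  ... | inj₁ d≡u-v =
    ≤-trans (≤-reflexive d≡u-v) (≤-trans (∸-monoˡ-≤ (toℕ v) (≤-pred (toℕ<n u))) (m≤n⊔m (toℕ v) (m ∸ toℕ v)))
  ... | inj₂ d≡v-u =
    ≤-trans (≤-reflexive d≡v-u) (≤-trans (m∸n≤m (toℕ v) (toℕ u)) (m≤m⊔n (toℕ v) (m ∸ toℕ v)))
  m-v≤ecc : m ∸ toℕ v ≤ ecc (pathDist (suc m)) v
  m-v≤ecc = ≤-trans (m∸n≤∣m-n∣ m (toℕ v))
    (subst (λ x → ∣ x - toℕ v ∣ ≤ ecc (pathDist (suc m)) v) (toℕ-fromℕ m) (≤-ecc (pathDist (suc m)) (fromℕ m) v))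

vertex : ∀ {n x} → x < n → Σ (Fin n) λ X → toℕ X ≡ x
vertex x<n = fromℕ< x<n , toℕ-fromℕ< x<n

module PathBridge (n : ℕ) (f : Fin n → ℕ) (F : ℕ → ℕ) (f≗F : ∀ i → f i ≡ F (toℕ i)) where
  open Path n F

  d : Dist n
  d = pathDist n

  toHears : ∀ u {v} → InH d f u v → Hears (toℕ u) (toℕ v)
  toHears u {v} = subst (λ k → 0 < k × d u v ≤ k) (f≗F v)

  fromHears : ∀ u {v} → Hears (toℕ u) (toℕ v) → InH d f u v
  fromHears u {v} = subst (λ k → 0 < k × d u v ≤ k) (sym (f≗F v))

  isMaximalPacking⇒ : IsMaximalPacking d f → MaximalPacking
  isMaximalPacking⇒ mp@((broadcast , packingFin) , _) = record
    { packing = packing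
    ; bounded = bounded
    ; blocked = blocked
    }
    where
    packing : Packing
    packing u<n v<n w<n hv hw with vertex u<n | vertex v<n | vertex w<n
    ... | U , refl | V , refl | W , refl = cong toℕ (packingFin U V W (fromHears U hv) (fromHears U hw))
    bounded : ∀ v → v < n → F v ≤ pathEcc n v
    bounded v v<n with vertex v<n
    ... | V , refl = subst₂ _≤_ (f≗F V) (ecc-pathDist V) (proj₂ (broadcast V))
    blocked : ∀ v → v < n → F v < pathEcc n v → BlockedAt v
    blocked v v<n F<ecc with vertex v<n
    ... | V , refl with maximal⇒blocked d mp V (subst₂ _<_ (sym (f≗F V)) (sym (ecc-pathDist V)) F<ecc)
    ...   | x , dxv≤1+f , z , x-hears-z , z≢V =
      toℕ x , toℕ<n x , subst (λ k → d x V ≤ suc k) (f≗F V) dxv≤1+f ,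
      toℕ z , toℕ<n z , toHears x x-hears-z , λ z≡V → z≢V (toℕ-injective z≡V)

  ⇒isMaximalPacking : MaximalPacking → IsMaximalPacking d f
  ⇒isMaximalPacking mp = blocked⇒maximal d (broadcast , packingFin) blockedFin
    where
    open MaximalPacking mp
    f≤ecc : ∀ v → f v ≤ ecc d v
    f≤ecc v = subst₂ _≤_ (sym (f≗F v)) (sym (ecc-pathDist v)) (bounded (toℕ v) (toℕ<n v))
    broadcast : IsBroadcast d f
    broadcast v = ≤-trans (f≤ecc v) (ecc≤diam d v) , f≤ecc v
    packingFin : ∀ u v w → InH d f u v → InH d f u w → v ≡ w
    packingFin u v w hv hw = toℕ-injective (packing (toℕ<n u) (toℕ<n v) (toℕ<n w) (toHears u hv) (toHears u hw))
    blockedFin : ∀ v → f v < ecc d v → Blocked d f v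
    blockedFin v f<ecc with blocked (toℕ v) (toℕ<n v) (subst₂ _<_ (f≗F v) (ecc-pathDist v) f<ecc)
    ... | x , x<n , dxv≤1+F , z , z<n , x-hears-z , z≢v with vertex x<n | vertex z<n
    ...   | X , refl | Z , refl =
      X , subst (λ k → d X v ≤ suc k) (sym (f≗F v)) dxv≤1+F , Z , fromHears X x-hears-z , λ Z≡v → z≢v (cong toℕ Z≡v)

∑-tabulate : ∀ {m} (h : Fin m → ℕ) (G : ℕ → ℕ) → (∀ i → h i ≡ G (toℕ i)) → sum (tabulate h) ≡ ∑ m G
∑-tabulate {zero}  h G h≗G = refl
∑-tabulate {suc m} h G h≗G =
  trans (cong₂ _+_ (h≗G Fin.zero) (∑-tabulate (h ∘ Fin.suc) (G ∘ suc) (h≗G ∘ Fin.suc))) (sym (∑-+ 1 m G))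

cost≡∑ : ∀ {n} (f : Fin n → ℕ) (F : ℕ → ℕ) → (∀ i → f i ≡ F (toℕ i)) → cost f ≡ ∑ n F
cost≡∑ f F f≗F = trans (cong sum (map-tabulate (λ x → x) f)) (∑-tabulate f F f≗F)

extend : ∀ {n} → (Fin n → ℕ) → ℕ → ℕ
extend {n} f i with i <? n
... | yes i<n = f (fromℕ< i<n)
... | no  _   = 0

extend-toℕ : ∀ {n} (f : Fin n → ℕ) i → f i ≡ extend f (toℕ i)
extend-toℕ {n} f i with toℕ i <? n
... | yes i<n = cong f (sym (fromℕ<-toℕ i i<n))
... | no  i≮n = ⊥-elim (i≮n (toℕ<n i))

module LocalCheck (n : ℕ) (F : ℕ → ℕ) where
  open Path n F

  ActiveLeft ActiveRight ActiveAt : ℕ → ℕ → Set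
  ActiveLeft  k v = T (k ≤ᵇ v) × F (v ∸ k) ≡ 1
  ActiveRight k v = T (v + k <ᵇ n) × F (v + k) ≡ 1
  ActiveAt    k v = ActiveLeft k v ⊎ ActiveRight k v

  LocallyMaximal : ℕ → Set
  LocallyMaximal v =
      F v ≤ 1
    × (F v ≡ 1 → F (v + 1) ≡ 0 × F (v + 2) ≡ 0)
    × (F v ≡ 0 → ActiveAt 1 v ⊎ ActiveAt 2 v)
    × (F v ≡ 1 → (T (v ≤ᵇ 1) × T (not (v + 2 <ᵇ n))) ⊎ ActiveAt 3 v)

  activeAt? : ∀ k v → Dec (ActiveAt k v)
  activeAt? k v = (T? (k ≤ᵇ v) ×-dec (F (v ∸ k) ≟ 1)) ⊎-dec (T? (v + k <ᵇ n) ×-dec (F (v + k) ≟ 1))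

  locallyMaximal? : ∀ v → Dec (LocallyMaximal v)
  locallyMaximal? v =
        (F v ≤? 1)
    ×-dec ((F v ≟ 1) →-dec ((F (v + 1) ≟ 0) ×-dec (F (v + 2) ≟ 0)))
    ×-dec ((F v ≟ 0) →-dec (activeAt? 1 v ⊎-dec activeAt? 2 v))
    ×-dec ((F v ≟ 1) →-dec ((T? (v ≤ᵇ 1) ×-dec T? (not (v + 2 <ᵇ n))) ⊎-dec activeAt? 3 v))

  blocked-by-right : ∀ v k → v + suc k < n → F (v + suc k) ≡ 1 → k ≤ suc (F v) → BlockedAt v
  blocked-by-right v k z<n Fz≡1 k≤1+F =
    v + k , <-trans (+-monoʳ-< v ≤-refl) z<n , subst (_≤ suc (F v)) (sym (∣m+n-m∣≡n v k)) k≤1+F ,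
    v + suc k , z<n , (subst (0 <_) (sym Fz≡1) z<s , subst (_ ≤_) (sym Fz≡1) (≤-reflexive dxz≡1)) , m+1+n≢m v
    where
    dxz≡1 : ∣ v + k - v + suc k ∣ ≡ 1
    dxz≡1 = trans (∣m+n-m+o∣≡∣n-o∣ v k (suc k)) (∣m-1+m∣≡1 k)

  blocked-by-left : ∀ z k → z + suc k < n → F z ≡ 1 → k ≤ suc (F (z + suc k)) → BlockedAt (z + suc k)
  blocked-by-left z k v<n Fz≡1 k≤1+F =
    z + 1 , ≤-<-trans (+-monoʳ-≤ z (s≤s z≤n)) v<n , subst (_≤ suc (F (z + suc k))) (sym dxv≡k) k≤1+F ,
    z , ≤-<-trans (m≤m+n z _) v<n ,
    (subst (0 <_) (sym Fz≡1) z<s , subst (_ ≤_) (sym Fz≡1) (≤-reflexive (∣m+n-m∣≡n z 1))) ,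
    λ z≡v → m≢1+m+n z (trans z≡v (+-suc z k))
    where
    dxv≡k : ∣ z + 1 - z + suc k ∣ ≡ k
    dxv≡k = trans (∣m+n-m+o∣≡∣n-o∣ z 1 (suc k)) (∣-∣-identityˡ k)

  module _ (2≤n : 2 ≤ n) (local : ∀ {v} → v < n → LocallyMaximal v) where

    positive⇒one : ∀ {v} → v < n → 0 < F v → F v ≡ 1
    positive⇒one v<n F>0 = ≤-antisym (proj₁ (local v<n)) F>0

    spaced : ∀ v k → k ≤ 1 → v < n → F v ≡ 1 → F (v + suc k) ≡ 1 → ⊥
    spaced v zero       _ v<n Fv≡1 Fw≡1 = 0≢1+n (trans (sym (proj₁ (proj₁ (proj₂ (local v<n)) Fv≡1))) Fw≡1)
    spaced v (suc zero) _ v<n Fv≡1 Fw≡1 = 0≢1+n (trans (sym (proj₂ (proj₁ (proj₂ (local v<n)) Fv≡1))) Fw≡1)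
    spaced v (suc (suc k)) (s≤s ())

    ordered-close⇒⊥ : ∀ {v w} → v < w → w < n → 0 < F v → 0 < F w → ∣ v - w ∣ ≤ 2 → ⊥
    ordered-close⇒⊥ {v} {w} v<w w<n Fv>0 Fw>0 dvw≤2 =
      spaced v k (≤-pred (subst (_≤ 2) dvw≡1+k dvw≤2)) v<n (positive⇒one v<n Fv>0)
        (subst (λ x → F x ≡ 1) (sym v+1+k≡w) (positive⇒one w<n Fw>0))
      where
      v<n : v < n
      v<n = <-trans v<w w<n
      k : ℕ
      k = w ∸ suc v
      v+1+k≡w : v + suc k ≡ w
      v+1+k≡w = trans (+-suc v k) (m+[n∸m]≡n v<w)
      dvw≡1+k : ∣ v - w ∣ ≡ suc k
      dvw≡1+k = trans (cong (λ x → ∣ v - x ∣) (sym v+1+k≡w)) (∣m-m+n∣≡n v (suc k))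

    close⇒equal : ∀ {v w} → v < n → w < n → 0 < F v → 0 < F w → ∣ v - w ∣ ≤ 2 → v ≡ w
    close⇒equal {v} {w} v<n w<n Fv>0 Fw>0 dvw≤2 with <-cmp v w
    ... | tri< v<w _ _ = ⊥-elim (ordered-close⇒⊥ v<w w<n Fv>0 Fw>0 dvw≤2)
    ... | tri≈ _ v≡w _ = v≡w
    ... | tri> _ _ w<v = ⊥-elim (ordered-close⇒⊥ w<v v<n Fw>0 Fv>0 (subst (_≤ 2) (∣-∣-comm v w) dvw≤2))

    packing : Packing
    packing {u} {v} {w} _ v<n w<n (Fv>0 , duv≤F) (Fw>0 , duw≤F) =
      close⇒equal v<n w<n Fv>0 Fw>0 (≤-trans (∣-∣-triangle v u w) (+-mono-≤ dvu≤1 duw≤1))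
      where
      dvu≤1 : ∣ v - u ∣ ≤ 1
      dvu≤1 = subst₂ _≤_ (∣-∣-comm u v) (positive⇒one v<n Fv>0) duv≤F
      duw≤1 : ∣ u - w ∣ ≤ 1
      duw≤1 = subst (_ ≤_) (positive⇒one w<n Fw>0) duw≤F

    pathEcc≤1 : ∀ {v} → T (v ≤ᵇ 1) → T (not (v + 2 <ᵇ n)) → pathEcc n v ≤ 1
    pathEcc≤1 {v} v≤ᵇ1 v+2≮ᵇn = ⊔-lub (≤ᵇ⇒≤ v 1 v≤ᵇ1)
      (m≤n+o⇒m∸n≤o (n ∸ 1) v (m≤n+o⇒m∸n≤o n 1 (≤-trans n≤v+2 (≤-reflexive (+-suc v 1)))))
      where
      n≤v+2 : n ≤ v + 2
      n≤v+2 = ≮⇒≥ (λ v+2<n → subst T (Equivalence.to T-not-≡ v+2≮ᵇn) (<⇒<ᵇ v+2<n))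

    blocked-by-active : ∀ {v} k → v < n → k ≤ suc (F v) → ActiveAt (suc k) v → BlockedAt v
    blocked-by-active {v} k v<n k≤1+F (inj₁ (1+k≤ᵇv , F≡1)) =
      subst BlockedAt v-1-k+1+k≡v (blocked-by-left (v ∸ suc k) k (subst (_< n) (sym v-1-k+1+k≡v) v<n) F≡1
        (subst (λ x → k ≤ suc (F x)) (sym v-1-k+1+k≡v) k≤1+F))
      where
      v-1-k+1+k≡v : v ∸ suc k + suc k ≡ v
      v-1-k+1+k≡v = m∸n+n≡m (≤ᵇ⇒≤ (suc k) v 1+k≤ᵇv)
    blocked-by-active {v} k v<n k≤1+F (inj₂ (v+1+k<ᵇn , F≡1)) = blocked-by-right v k (<ᵇ⇒< _ n v+1+k<ᵇn) F≡1 k≤1+F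

    locallyMaximal⇒maximalPacking : MaximalPacking
    locallyMaximal⇒maximalPacking = record
      { packing = packing
      ; bounded = λ v v<n → ≤-trans (proj₁ (local v<n)) (1≤pathEcc 2≤n v)
      ; blocked = blocked
      }
      where
      blocked : ∀ v → v < n → F v < pathEcc n v → BlockedAt v
      blocked v v<n F<ecc with proj₂ (proj₂ (local v<n)) | F v ≟ 0
      ... | silent⇒ , _ | yes F≡0 with silent⇒ F≡0
      ...   | inj₁ active₁ = blocked-by-active 0 v<n z≤n active₁
      ...   | inj₂ active₂ = blocked-by-active 1 v<n (s≤s z≤n) active₂
      blocked v v<n F<ecc | _ , active⇒ | no F≢0 with active⇒ F≡1
        where
        F≡1 : F v ≡ 1
        F≡1 = positive⇒one v<n (n≢0⇒n>0 F≢0)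
      ...   | inj₁ (v≤ᵇ1 , v+2≮ᵇn) = ⊥-elim (<⇒≱ F<ecc (≤-trans (pathEcc≤1 v≤ᵇ1 v+2≮ᵇn) (n≢0⇒n>0 F≢0)))
      ...   | inj₂ active₃ = blocked-by-active 2 v<n (s≤s (n≢0⇒n>0 F≢0)) active₃

open LocalCheck using (LocallyMaximal; locallyMaximal?; locallyMaximal⇒maximalPacking)
open Path using (MaximalPacking)

AllLocallyMaximal : ℕ → (ℕ → ℕ) → ℕ → Set
AllLocallyMaximal n F k = ∀ {v} → v < k → LocallyMaximal n F v

allLocallyMaximal? : ∀ n F k → Dec (AllLocallyMaximal n F k)
allLocallyMaximal? n F = allUpTo? (locallyMaximal? n F)

block : ℕ → ℕ
block 2 = 1
block 5 = 1
block _ = 0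

blocksThen : ℕ → (ℕ → ℕ) → ℕ → ℕ
blocksThen zero    B v = B v
blocksThen (suc q) B (suc (suc (suc (suc (suc (suc (suc (suc v)))))))) = blocksThen q B v
blocksThen (suc q) B v = block v

-- LocallyMaximal inspects only F on [v - 3, v + 3] and compares with n through boolean tests, so
-- at v = 11 + w in the longer pattern it reduces definitionally to LocallyMaximal at 3 + w in the
-- shorter one; the first 11 vertices are checked by evaluation.
blocksThen-locallyMaximal : ∀ q b B → AllLocallyMaximal b B b → AllLocallyMaximal (8 + b) (blocksThen 1 B) 11 →
                            AllLocallyMaximal (q * 8 + b) (blocksThen q B) (q * 8 + b)
blocksThen-locallyMaximal zero    b B base _     = base
blocksThen-locallyMaximal (suc q) b B base first {v} v<n with v <? 11
... | yes v<11 = first-window q v<11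
  where
  first-window : ∀ q → AllLocallyMaximal (suc q * 8 + b) (blocksThen (suc q) B) 11
  first-window zero    = first
  first-window (suc q) = toWitness {a? = allLocallyMaximal? (suc (suc q) * 8 + b) (blocksThen (suc (suc q)) B) 11} _
... | no  v≮11 = subst (LocallyMaximal (suc q * 8 + b) (blocksThen (suc q) B)) 11+w≡v
  (blocksThen-locallyMaximal q b B base first (+-cancelˡ-< 8 (3 + w) (q * 8 + b) (subst (_< suc q * 8 + b) (sym 11+w≡v) v<n)))
  where
  w : ℕ
  w = v ∸ 11
  11+w≡v : 11 + w ≡ v
  11+w≡v = m+[n∸m]≡n (≮⇒≥ v≮11)

[8+x]/8≡1+x/8 : ∀ x → (8 + x) / 8 ≡ suc (x / 8)
[8+x]/8≡1+x/8 x = m/n≡1+[m∸n]/n {8 + x} {8} (m≤m+n 8 x)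

[8+x]/4≡2+x/4 : ∀ x → (8 + x) / 4 ≡ 2 + x / 4
[8+x]/4≡2+x/4 x = trans (m/n≡1+[m∸n]/n {8 + x} {4} (m≤m+n 4 (4 + x))) (cong suc (m/n≡1+[m∸n]/n {4 + x} {4} (m≤m+n 4 x)))

2[1+t]+c≡2+[2t+c] : ∀ t c → 2 * suc t + c ≡ 2 + (2 * t + c)
2[1+t]+c≡2+[2t+c] = solve-∀

-- (8 + x) % 8 reduces to x % 8, so both sides take the same branch of pbPathValue.
pbPathValue-8+ : ∀ x → pbPathValue (8 + x) ≡ 2 + pbPathValue x
pbPathValue-8+ x with x % 8
... | 0 = [8+x]/4≡2+x/4 x
... | 1 = trans (cong (λ t → 2 * t + 1) ([8+x]/8≡1+x/8 x)) (2[1+t]+c≡2+[2t+c] (x / 8) 1)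
... | 2 = trans (cong (λ t → 2 * t + 1) ([8+x]/8≡1+x/8 x)) (2[1+t]+c≡2+[2t+c] (x / 8) 1)
... | 3 = trans (cong (λ t → 2 * t + 1) ([8+x]/8≡1+x/8 x)) (2[1+t]+c≡2+[2t+c] (x / 8) 1)
... | suc (suc (suc (suc _))) = trans (cong (λ t → 2 * t + 2) ([8+x]/8≡1+x/8 x)) (2[1+t]+c≡2+[2t+c] (x / 8) 2)

pbPathValue-blocksThen : ∀ q b → pbPathValue (q * 8 + b) ≡ 2 * q + pbPathValue b
pbPathValue-blocksThen zero    b = refl
pbPathValue-blocksThen (suc q) b = trans (pbPathValue-8+ (q * 8 + b))
  (trans (cong (2 +_) (pbPathValue-blocksThen q b)) (sym (2[1+t]+c≡2+[2t+c] q (pbPathValue b))))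

∑-blocksThen : ∀ q b B → ∑ (q * 8 + b) (blocksThen q B) ≡ 2 * q + ∑ b B
∑-blocksThen zero    b B = refl
∑-blocksThen (suc q) b B = begin
  ∑ (8 + (q * 8 + b)) (blocksThen (suc q) B)   ≡⟨ ∑-+ 8 (q * 8 + b) (blocksThen (suc q) B) ⟩
  2 + ∑ (q * 8 + b) (blocksThen q B)           ≡⟨ cong (2 +_) (∑-blocksThen q b B) ⟩
  2 + (2 * q + ∑ b B)                          ≡⟨ 2[1+t]+c≡2+[2t+c] q (∑ b B) ⟨
  2 * suc q + ∑ b B                            ∎
  where open ≡-Reasoning

fromList : List ℕ → ℕ → ℕ
fromList []       _       = 0
fromList (x ∷ _)  zero    = x
fromList (_ ∷ xs) (suc v) = fromList xs v

Realised : ℕ → Set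
Realised n = ∃ λ F → MaximalPacking n F × ∑ n F ≡ pbPathValue n

realised-by : ∀ n (l : List ℕ) → 2 ≤ n → True (allLocallyMaximal? n (fromList l) n) →
              ∑ n (fromList l) ≡ pbPathValue n → Realised n
realised-by n l 2≤n checked cost = fromList l , locallyMaximal⇒maximalPacking n (fromList l) 2≤n (toWitness checked) , cost

PeriodicBase : ℕ → Set
PeriodicBase b = Σ (ℕ → ℕ) λ B →
  AllLocallyMaximal b B b × AllLocallyMaximal (8 + b) (blocksThen 1 B) 11 × ∑ b B ≡ pbPathValue b

periodicBase-by : ∀ b (l : List ℕ) → True (allLocallyMaximal? b (fromList l) b) →
                  True (allLocallyMaximal? (8 + b) (blocksThen 1 (fromList l)) 11) →
                  ∑ b (fromList l) ≡ pbPathValue b → PeriodicBase b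
periodicBase-by b l checked checked-window cost = fromList l , toWitness checked , toWitness checked-window , cost

periodicBase : ∀ r → r < 8 → PeriodicBase (8 + r)
periodicBase 0 _ = periodicBase-by 8  (0 ∷ 0 ∷ 1 ∷ 0 ∷ 0 ∷ 1 ∷ 0 ∷ 0 ∷ []) _ _ refl
periodicBase 1 _ = periodicBase-by 9  (0 ∷ 0 ∷ 1 ∷ 0 ∷ 0 ∷ 1 ∷ 0 ∷ 0 ∷ 1 ∷ []) _ _ refl
periodicBase 2 _ = periodicBase-by 10 (0 ∷ 0 ∷ 1 ∷ 0 ∷ 0 ∷ 1 ∷ 0 ∷ 0 ∷ 1 ∷ 0 ∷ []) _ _ refl
periodicBase 3 _ = periodicBase-by 11 (0 ∷ 0 ∷ 1 ∷ 0 ∷ 0 ∷ 1 ∷ 0 ∷ 0 ∷ 1 ∷ 0 ∷ 0 ∷ []) _ _ refl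
periodicBase 4 _ = periodicBase-by 12 (0 ∷ 0 ∷ 1 ∷ 0 ∷ 0 ∷ 1 ∷ 0 ∷ 0 ∷ 1 ∷ 0 ∷ 0 ∷ 1 ∷ []) _ _ refl
periodicBase 5 _ = periodicBase-by 13 (0 ∷ 0 ∷ 1 ∷ 0 ∷ 0 ∷ 1 ∷ 0 ∷ 0 ∷ 1 ∷ 0 ∷ 0 ∷ 1 ∷ 0 ∷ []) _ _ refl
periodicBase 6 _ = periodicBase-by 14 (0 ∷ 0 ∷ 1 ∷ 0 ∷ 0 ∷ 1 ∷ 0 ∷ 0 ∷ 1 ∷ 0 ∷ 0 ∷ 1 ∷ 0 ∷ 0 ∷ []) _ _ refl
periodicBase 7 _ = periodicBase-by 15 (0 ∷ 0 ∷ 1 ∷ 0 ∷ 0 ∷ 1 ∷ 0 ∷ 0 ∷ 0 ∷ 1 ∷ 0 ∷ 0 ∷ 1 ∷ 0 ∷ 0 ∷ []) _ _ refl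
periodicBase (suc (suc (suc (suc (suc (suc (suc (suc _)))))))) (s≤s (s≤s (s≤s (s≤s (s≤s (s≤s (s≤s (s≤s ()))))))))

realised-periodic : ∀ q b → 2 ≤ b → PeriodicBase b → Realised (q * 8 + b)
realised-periodic q b 2≤b (B , base , first , cost) =
  blocksThen q B ,
  locallyMaximal⇒maximalPacking (q * 8 + b) (blocksThen q B) (≤-trans 2≤b (m≤n+m b (q * 8)))
    (blocksThen-locallyMaximal q b B base first) ,
  trans (∑-blocksThen q b B) (trans (cong (2 * q +_) cost) (sym (pbPathValue-blocksThen q b)))

realised : ∀ n → 2 ≤ n → Realised n
realised 0 ()
realised 1 (s≤s ())
realised 2 2≤n = realised-by 2 (1 ∷ 0 ∷ []) 2≤n _ refl
realised 3 2≤n = realised-by 3 (0 ∷ 1 ∷ 0 ∷ []) 2≤n _ refl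
realised 4 2≤n = realised-by 4 (1 ∷ 0 ∷ 0 ∷ 1 ∷ []) 2≤n _ refl
realised 5 2≤n = realised-by 5 (1 ∷ 0 ∷ 0 ∷ 1 ∷ 0 ∷ []) 2≤n _ refl
realised 6 2≤n = realised-by 6 (1 ∷ 0 ∷ 0 ∷ 1 ∷ 0 ∷ 0 ∷ []) 2≤n _ refl
realised 7 2≤n = realised-by 7 (0 ∷ 1 ∷ 0 ∷ 0 ∷ 1 ∷ 0 ∷ 0 ∷ []) 2≤n _ refl
realised (suc (suc (suc (suc (suc (suc (suc (suc m)))))))) _ =
  subst Realised (sym 8+m≡)
    (realised-periodic (m / 8) (8 + m % 8) (≤-trans (s≤s (s≤s z≤n)) (m≤m+n 8 (m % 8))) (periodicBase (m % 8) (m%n<n m 8)))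
  where
  8+m≡ : 8 + m ≡ m / 8 * 8 + (8 + m % 8)
  8+m≡ = trans (cong (8 +_) (m≡m%n+[m/n]*n m 8)) (regroup (m % 8) (m / 8))
    where
    regroup : ∀ r t → 8 + (r + t * 8) ≡ t * 8 + (8 + r)
    regroup = solve-∀

theorem3p16 : ∀ (n : ℕ) → 2 ≤ n → PbIs (pathDist n) (pbPathValue n)
theorem3p16 n 2≤n = attained (realised n 2≤n) , least
  where
  attained : Realised n → Σ _ λ f → IsMaximalPacking (pathDist n) f × cost f ≡ pbPathValue n
  attained (F , mp , ∑F≡) =
    F ∘ toℕ , PathBridge.⇒isMaximalPacking n (F ∘ toℕ) F (λ _ → refl) mp ,
    trans (cost≡∑ {n} (F ∘ toℕ) F (λ _ → refl)) ∑F≡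
  least : ∀ f → IsMaximalPacking (pathDist n) f → pbPathValue n ≤ cost f
  least f mp = subst (pbPathValue n ≤_) (sym (cost≡∑ f (extend f) (extend-toℕ f)))
    (pbPathValue≤∑ n (extend f) 2≤n (PathBridge.isMaximalPacking⇒ n f (extend f) (extend-toℕ f) mp))
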